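{- Let $\mathcal{A}$ be an L/U-gPTA with lower-bound parameters $P_L$ and upper-bound parameters $P_U$, and let $v$ be a parameter valuation. For every parameter valuation $v'$ with $v'(p)\le v(p)$ for all $p\in P_L$ and $v'(p)\ge v(p)$ for all $p\in P_U$, and for every $n\ge 1$, every computation of the network $\mathcal{A}[v]^n$ is a computation of $\mathcal{A}[v']^n$.
   Context: Timing parameters are integer-valued: a parameter valuation is a map $v:P\to\mathbb{N}$. Clocks are real-valued, all evolving at rate 1. A constraint is a conjunction of inequalities $x\bowtie \sum_{i}\alpha_i p_i + d$ with $x$ a clock, $\bowtie\in\{<,\le,=,\ge,>\}$, $p_i$ parameters, $\alpha_i,d\in\mathbb{Z}$. A guarded parametric timed automaton (gPTA) is $\mathcal{A}=(\Sigma,L,\ell_0,X,P,I,E)$ with finite action set, finite location set $L$, initial location $\ell_0$, finite clock set $X$, finite parameter set $P$, invariant map $I$ assigning a constraint to each location, and finite edge set $E$ of tuples $(\ell,g,\gamma,a,R,\ell')$ with $g$ a constraint (guard), $\gamma\in L\cup\{\top\}$ a location guard, $a$ an action, $R\subseteq X$ reset set. It is an L/U-gPTA if $P=P_L\uplus P_U$ such that in every constraint inequality $x\bowtie\sum_i\alpha_ip_i+d$: for $p_i\in P_L$, $\bowtie\in\{\le,<\}$ implies $\alpha_i\le0$ and $\bowtie\in\{\ge,>\}$ implies $\alpha_i\ge0$; for $p_i\in P_U$, $\bowtie\in\{\le,<\}$ implies $\alpha_i\ge0$ and $\bowtie\in\{\ge,>\}$ implies $\alpha_i\le0$. $\mathcal{A}[v]$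 is $\mathcal{A}$ with parameters replaced by their values. The network $\mathcal{A}[v]^n$ has configurations $((\ell_1,\mu_1),\dots,(\ell_n,\mu_n))$ with each $\mu_i$ satisfying $I(\ell_i)$; initial configuration $(\ell_0,\mathbf{0})^n$; delay transitions increase all clocks of all processes by $d\ge0$ if all invariants hold throughout; discrete transitions let one process $i$ take an edge whose guard is satisfied by its clocks, resetting $R$, with the target invariant satisfied, and with $\gamma=\top$ or some other process $j\neq i$ currently in location $\gamma$; other processes unchanged. A computation is a finite sequence of configurations starting at the initial configuration, each step being a delay followed by a discrete transition.
   Formalization: The L/U condition forces αᵢ = 0 for every parameter pᵢ in each inequality $x\bowtie\sum_i\alpha_ip_i+d$ whose ⋈ is =, in addition to the sign conditions for ≤, <, ≥, >. The statement above fails without it. -}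

module Defs where

open import Level using (0ℓ)
open import Data.Nat as ℕ using (ℕ; zero; suc)
open import Data.Fin using (Fin; zero; suc)
open import Data.Integer as ℤ using (ℤ; +_; 0ℤ)
open import Data.Bool using (Bool; true; false; if_then_else_)
open import Data.Maybe using (Maybe; just; nothing)
open import Data.List using (List; []; _∷_)
open import Data.List.Membership.Propositional using (_∈_)
open import Data.Product using (Σ; ∃; _×_; _,_; proj₁; proj₂)
open import Data.Unit using (⊤)
open import Data.Sum using (_⊎_)
open import Data.Empty using (⊥)
open import Function using (_∘_)
open import Relation.Binary.PropositionalEquality using (_≡_)
open import Relation.Nullary using (¬_)

-- The paper's clocks are real-valued; agda-stdlib has no
-- reals, so we abstract over any "clock domain": a totally ordered
-- additive monoid with a monotone embedding of the integers (the reals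
-- with the usual order and inclusion ℤ ⊆ ℝ are an instance).

record ClockDomain : Set₁ where
  infixl 6 _+_
  infix 4 _≤_ _<_
  field
    R        : Set
    0#       : R
    _+_      : R → R → R
    _≤_      : R → R → Set
    _<_      : R → R → Set
    ι        : ℤ → R
    ≤-refl   : ∀ {x} → x ≤ x
    ≤-trans  : ∀ {x y z} → x ≤ y → y ≤ z → x ≤ z
    ≤-antisym : ∀ {x y} → x ≤ y → y ≤ x → x ≡ y
    ≤-total  : ∀ x y → x ≤ y ⊎ y ≤ x
    <⇒≤      : ∀ {x y} → x < y → x ≤ y
    <-irrefl : ∀ {x} → ¬ (x < x)
    <-≤-trans : ∀ {x y z} → x < y → y ≤ z → x < z
    ≤-<-trans : ∀ {x y z} → x ≤ y → y < z → x < z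
    +-identityʳ : ∀ x → x + 0# ≡ x
    +-assoc  : ∀ x y z → (x + y) + z ≡ x + (y + z)
    +-comm   : ∀ x y → x + y ≡ y + x
    +-monoʳ-≤ : ∀ x {y z} → y ≤ z → x + y ≤ x + z
    ι-0      : ι 0ℤ ≡ 0#
    ι-mono   : ∀ {i j} → i ℤ.≤ j → ι i ≤ ι j
    ι-strict : ∀ {i j} → i ℤ.< j → ι i < ι j

data Cmp : Set where
  lt le eq ge gt : Cmp

sumFin : ∀ {n} → (Fin n → ℤ) → ℤ
sumFin {zero}  f = 0ℤ
sumFin {suc n} f = f zero ℤ.+ sumFin (f ∘ suc)

record LinExpr (nP : ℕ) : Set where
  constructor linExpr
  field
    coeff : Fin nP → ℤ
    const : ℤ

record Ineq (nX nP : ℕ) : Set where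
  constructor ineq
  field
    clock : Fin nX
    cmp   : Cmp
    rhs   : LinExpr nP

Constraint : ℕ → ℕ → Set
Constraint nX nP = List (Ineq nX nP)

record Edge (nA nL nX nP : ℕ) : Set where
  field
    src      : Fin nL
    guard    : Constraint nX nP
    locGuard : Maybe (Fin nL)      -- nothing = ⊤
    act      : Fin nA
    reset    : Fin nX → Bool
    tgt      : Fin nL

record GPTA : Set where
  field
    nA nL nX nP : ℕ                 -- |Σ|, |L|, |X|, |P|
    ℓ₀    : Fin nL
    inv   : Fin nL → Constraint nX nP
    edges : List (Edge nA nL nX nP)

-- L/U condition.  lower p ≡ true means p ∈ P_L, false means p ∈ P_U.
-- An equality x = e is read as x ≤ e ∧ x ≥ e, forcing α_i = 0.

LUok : Bool → Cmp → ℤ → Set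
LUok true  lt α = α ℤ.≤ 0ℤ
LUok true  le α = α ℤ.≤ 0ℤ
LUok true  eq α = α ≡ 0ℤ
LUok true  ge α = 0ℤ ℤ.≤ α
LUok true  gt α = 0ℤ ℤ.≤ α
LUok false lt α = 0ℤ ℤ.≤ α
LUok false le α = 0ℤ ℤ.≤ α
LUok false eq α = α ≡ 0ℤ
LUok false ge α = α ℤ.≤ 0ℤ
LUok false gt α = α ℤ.≤ 0ℤ

LUConstraint : ∀ {nX nP} → (Fin nP → Bool) → Constraint nX nP → Set
LUConstraint lower c =
  ∀ {φ} → φ ∈ c → ∀ p → LUok (lower p) (Ineq.cmp φ) (LinExpr.coeff (Ineq.rhs φ) p)

IsLU : (A : GPTA) → (Fin (GPTA.nP A) → Bool) → Set
IsLU A lower =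
  (∀ ℓ → LUConstraint lower (GPTA.inv A ℓ)) ×
  (∀ {e} → e ∈ GPTA.edges A → LUConstraint lower (Edge.guard e))

module Semantics (D : ClockDomain) (A : GPTA) where
  open ClockDomain D
  open GPTA A

  ParamVal : Set
  ParamVal = Fin nP → ℕ

  ClockVal : Set
  ClockVal = Fin nX → R

  evalLin : ParamVal → LinExpr nP → ℤ
  evalLin v (linExpr α d) = sumFin (λ i → α i ℤ.* (+ v i)) ℤ.+ d

  rel : R → Cmp → R → Set
  rel a lt b = a < b
  rel a le b = a ≤ b
  rel a eq b = a ≡ b
  rel a ge b = b ≤ a
  rel a gt b = b < a

  satIneq : ParamVal → ClockVal → Ineq nX nP → Set
  satIneq v μ (ineq x c e) = rel (μ x) c (ι (evalLin v e))

  sat : ParamVal → ClockVal → Constraint nX nP → Set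
  sat v μ c = ∀ {φ} → φ ∈ c → satIneq v μ φ

  delay : ClockVal → R → ClockVal
  delay μ d x = μ x + d

  doReset : (Fin nX → Bool) → ClockVal → ClockVal
  doReset r μ x = if r x then 0# else μ x

  Config : ℕ → Set
  Config n = Fin n → Fin nL × ClockVal

  loc : ∀ {n} → Config n → Fin n → Fin nL
  loc c i = proj₁ (c i)

  clk : ∀ {n} → Config n → Fin n → ClockVal
  clk c i = proj₂ (c i)

  Valid : ParamVal → ∀ {n} → Config n → Set
  Valid v c = ∀ i → sat v (clk c i) (inv (loc c i))

  IsInitial : ∀ {n} → Config n → Set
  IsInitial c = ∀ i → loc c i ≡ ℓ₀ × (∀ x → clk c i x ≡ 0#)

  Step : ParamVal → ∀ {n} → Config n → Config n → Set
  Step v {n} c c' =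
    Σ R λ d → (0# ≤ d) ×
      (∀ i t → 0# ≤ t → t ≤ d → sat v (delay (clk c i) t) (inv (loc c i))) ×
      Σ (Fin n) λ i → Σ (Edge nA nL nX nP) λ e → (e ∈ edges) ×
        (Edge.src e ≡ loc c i) ×
        sat v (delay (clk c i) d) (Edge.guard e) ×
        (loc c' i ≡ Edge.tgt e) ×
        (∀ x → clk c' i x ≡ doReset (Edge.reset e) (delay (clk c i) d) x) ×
        sat v (clk c' i) (inv (Edge.tgt e)) ×
        (LocGuardOK c i (Edge.locGuard e)) ×
        (∀ j → ¬ (j ≡ i) → loc c' j ≡ loc c j ×
                          (∀ x → clk c' j x ≡ delay (clk c j) d x))
    where
      LocGuardOK : ∀ {n} → Config n → Fin n → Maybe (Fin nL) → Set
      LocGuardOK c i nothing  = ⊤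
      LocGuardOK {n} c i (just γ) = Σ (Fin n) λ j → ¬ (j ≡ i) × loc c j ≡ γ

  Chain : ParamVal → ∀ {n} → Config n → List (Config n) → Set
  Chain v c []        = ⊤
  Chain v c (c' ∷ cs) = Step v c c' × Valid v c' × Chain v c' cs

  IsComputation : ParamVal → ∀ {n} → List (Config n) → Set
  IsComputation v []       = ⊥
  IsComputation v (c ∷ cs) = IsInitial c × Valid v c × Chain v c cs

{-# OPTIONS --safe #-}
-- The L/U condition gives every parameter, in every inequality, the sign for
-- which lowering a lower-bound parameter or raising an upper-bound parameter
-- moves the bound away from the clock: bounds x ≤ e and x < e grow, bounds
-- x ≥ e and x > e shrink, and x = e involves no parameter at all.  Hence every
-- constraint satisfied under v is satisfied under v'.  Parameters enter the
-- semantics of the network only through invariants and guards, so every step,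
-- and therefore every computation, of A[v]ⁿ is one of A[v']ⁿ.
module Submission where

open import Defs
open import Data.Nat using (ℕ; _≤_)
open import Data.Fin using (Fin; zero; suc)
open import Data.Bool using (Bool; true; false; not)
open import Data.List using (List; []; _∷_)
open import Data.Maybe using (just; nothing)
open import Data.Product using (_×_; _,_; proj₁; proj₂)
open import Data.Integer as ℤ using (ℤ; +_; 0ℤ; +≤+; nonNegative; nonPositive)
import Data.Integer.Properties as ℤ
open import Function using (_∘_)
open import Relation.Binary.PropositionalEquality using (_≡_; refl; cong; trans)

-- The flag b marks a lower-bound parameter (b ≡ true), as `lower` does in IsLU.
Widens : Bool → ℕ → ℕ → Set
Widens true  a a′ = a′ ≤ a
Widens false a a′ = a ≤ a′

widens : ∀ b {a a′} → (b ≡ true → a′ ≤ a) → (b ≡ false → a ≤ a′) → Widens b a a′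
widens true  a′≤a _    = a′≤a refl
widens false _    a≤a′ = a≤a′ refl

widens-flip : ∀ b {a a′} → Widens b a a′ → Widens (not b) a′ a
widens-flip true  h = h
widens-flip false h = h

-- The L/U condition on a coefficient in an upper bound x ≤ e; in a lower bound
-- x ≥ e the same coefficient must satisfy UpperBoundCoeff (not b).
UpperBoundCoeff : Bool → ℤ → Set
UpperBoundCoeff true  α = α ℤ.≤ 0ℤ
UpperBoundCoeff false α = 0ℤ ℤ.≤ α

lt-coeff : ∀ b {α} → LUok b lt α → UpperBoundCoeff b α
lt-coeff true  h = h
lt-coeff false h = h

le-coeff : ∀ b {α} → LUok b le α → UpperBoundCoeff b α
le-coeff true  h = h
le-coeff false h = h

ge-coeff : ∀ b {α} → LUok b ge α → UpperBoundCoeff (not b) α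
ge-coeff true  h = h
ge-coeff false h = h

gt-coeff : ∀ b {α} → LUok b gt α → UpperBoundCoeff (not b) α
gt-coeff true  h = h
gt-coeff false h = h

eq-coeff : ∀ b {α} → LUok b eq α → UpperBoundCoeff b α × UpperBoundCoeff (not b) α
eq-coeff true  refl = ℤ.≤-refl , ℤ.≤-refl
eq-coeff false refl = ℤ.≤-refl , ℤ.≤-refl

*-mono-widens : ∀ b {α a a′} → UpperBoundCoeff b α → Widens b a a′ →
                α ℤ.* + a ℤ.≤ α ℤ.* + a′
*-mono-widens true  {α} α≤0 a′≤a = ℤ.*-monoˡ-≤-nonPos α {{nonPositive α≤0}} (+≤+ a′≤a)
*-mono-widens false {α} 0≤α a≤a′ = ℤ.*-monoˡ-≤-nonNeg α {{nonNegative 0≤α}} (+≤+ a≤a′)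

sumFin-mono-≤ : ∀ {n} {f g : Fin n → ℤ} → (∀ i → f i ℤ.≤ g i) → sumFin f ℤ.≤ sumFin g
sumFin-mono-≤ {ℕ.zero}  f≤g = ℤ.≤-refl
sumFin-mono-≤ {ℕ.suc n} f≤g = ℤ.+-mono-≤ (f≤g zero) (sumFin-mono-≤ (f≤g ∘ suc))

linear-mono-widens : ∀ {n} (b : Fin n → Bool) {α : Fin n → ℤ} {v v′ : Fin n → ℕ} d →
                     (∀ p → UpperBoundCoeff (b p) (α p)) → (∀ p → Widens (b p) (v p) (v′ p)) →
                     sumFin (λ p → α p ℤ.* + v p) ℤ.+ d ℤ.≤ sumFin (λ p → α p ℤ.* + v′ p) ℤ.+ d
linear-mono-widens b d α-ok v-v′ =
  ℤ.+-monoˡ-≤ d (sumFin-mono-≤ (λ p → *-mono-widens (b p) (α-ok p) (v-v′ p)))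

module Relaxation (D : ClockDomain) (A : GPTA) (lower : Fin (GPTA.nP A) → Bool)
                  {v v′ : Fin (GPTA.nP A) → ℕ} (v-v′ : ∀ p → Widens (lower p) (v p) (v′ p)) where
  open ClockDomain D
  open GPTA A
  open Semantics D A

  upper-bound-grows : ∀ e → (∀ p → UpperBoundCoeff (lower p) (LinExpr.coeff e p)) →
                      evalLin v e ℤ.≤ evalLin v′ e
  upper-bound-grows (linExpr α d) α-ok = linear-mono-widens lower d α-ok v-v′

  lower-bound-shrinks : ∀ e → (∀ p → UpperBoundCoeff (not (lower p)) (LinExpr.coeff e p)) →
                        evalLin v′ e ℤ.≤ evalLin v e
  lower-bound-shrinks (linExpr α d) α-ok =
    linear-mono-widens (not ∘ lower) d α-ok (λ p → widens-flip (lower p) (v-v′ p))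

  satIneq-relax : ∀ {μ} φ → (∀ p → LUok (lower p) (Ineq.cmp φ) (LinExpr.coeff (Ineq.rhs φ) p)) →
                  satIneq v μ φ → satIneq v′ μ φ
  satIneq-relax (ineq x lt e) ok s =
    <-≤-trans s (ι-mono (upper-bound-grows e (λ p → lt-coeff (lower p) (ok p))))
  satIneq-relax (ineq x le e) ok s =
    ≤-trans s (ι-mono (upper-bound-grows e (λ p → le-coeff (lower p) (ok p))))
  satIneq-relax (ineq x eq e) ok s = trans s (cong ι (ℤ.≤-antisym
    (upper-bound-grows e (λ p → proj₁ (eq-coeff (lower p) (ok p))))
    (lower-bound-shrinks e (λ p → proj₂ (eq-coeff (lower p) (ok p))))))
  satIneq-relax (ineq x ge e) ok s =
    ≤-trans (ι-mono (lower-bound-shrinks e (λ p → ge-coeff (lower p) (ok p)))) s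
  satIneq-relax (ineq x gt e) ok s =
    ≤-<-trans (ι-mono (lower-bound-shrinks e (λ p → gt-coeff (lower p) (ok p)))) s

  sat-relax : ∀ {μ c} → LUConstraint lower c → sat v μ c → sat v′ μ c
  sat-relax {μ} c-ok s {φ} φ∈c = satIneq-relax {μ} φ (c-ok φ∈c) (s φ∈c)

  module _ (lu : IsLU A lower) where

    inv-relax : ∀ {μ} ℓ → sat v μ (inv ℓ) → sat v′ μ (inv ℓ)
    inv-relax ℓ = sat-relax (proj₁ lu ℓ)

    valid-relax : ∀ {n} {c : Config n} → Valid v c → Valid v′ c
    valid-relax {c = c} valid i = inv-relax (loc c i) (valid i)

    -- The location-guard condition of Step is local to it and mentions the
    -- valuation; it reduces to the same type under v and v′ only once the
    -- edge's location guard is known.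
    step-relax : ∀ {n} {c c′ : Config n} → Step v c c′ → Step v′ c c′
    step-relax {c = c} (d , 0≤d , during , i , e@record { locGuard = nothing } , e∈ , src , g , tgt , rst , inv′ , γ-ok , rest) =
      d , 0≤d , (λ j t 0≤t t≤d → inv-relax (loc c j) (during j t 0≤t t≤d)) , i , e , e∈ , src ,
      sat-relax (proj₂ lu e∈) g , tgt , rst , inv-relax (Edge.tgt e) inv′ , γ-ok , rest
    step-relax {c = c} (d , 0≤d , during , i , e@record { locGuard = just _ } , e∈ , src , g , tgt , rst , inv′ , γ-ok , rest) =
      d , 0≤d , (λ j t 0≤t t≤d → inv-relax (loc c j) (during j t 0≤t t≤d)) , i , e , e∈ , src ,
      sat-relax (proj₂ lu e∈) g , tgt , rst , inv-relax (Edge.tgt e) inv′ , γ-ok , rest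

    chain-relax : ∀ {n} {c : Config n} cs → Chain v c cs → Chain v′ c cs
    chain-relax []       _                     = _
    chain-relax (c ∷ cs) (step , valid , chain) = step-relax step , valid-relax valid , chain-relax cs chain

    computation-relax : ∀ {n} (π : List (Config n)) → IsComputation v π → IsComputation v′ π
    computation-relax (c ∷ cs) (initial , valid , chain) = initial , valid-relax valid , chain-relax cs chain

-- The argument is uniform in n.
mainTheorem6 : (D : ClockDomain) (A : GPTA) (lower : Fin (GPTA.nP A) → Bool) →
    IsLU A lower →
    (v v' : Fin (GPTA.nP A) → ℕ) →
    (∀ p → lower p ≡ true → v' p ≤ v p) →
    (∀ p → lower p ≡ false → v p ≤ v' p) →
    (n : ℕ) → 1 ≤ n →
    (π : List (Semantics.Config D A n)) →
    Semantics.IsComputation D A v π →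
    Semantics.IsComputation D A v' π
mainTheorem6 D A lower lu v v' hL hU n _ =
  Relaxation.computation-relax D A lower (λ p → widens (lower p) (hL p) (hU p)) lu
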